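{- Let $\varepsilon=(E,\leadsto,\mapsto,l)$ be an Extended Bundle Event Structure and let $\lessdot'\subseteq\lessdot\subseteq E\times E$ be acyclic relations, so that $(\varepsilon,\lessdot)$ and $(\varepsilon,\lessdot')$ are prioritized Extended Bundle Event Structures. Then $\mathrm{Traces}(\varepsilon,\lessdot)\subseteq\mathrm{Traces}(\varepsilon,\lessdot')$.
   Context: An Extended Bundle Event Structure (EBES) is a quadruple $\varepsilon=(E,\leadsto,\mapsto,l)$ where $E$ is a set of events, $\leadsto\subseteq E\times E$ is an irreflexive relation (disabling; $e\leadsto e'$ means that once $e'$ has occurred, $e$ can no longer occur), $\mapsto\subseteq\mathcal{P}(E)\times E$ is the enabling relation (a pair $(X,e)$ is written $X\mapsto e$), and $l:E\to Act$ is a labeling function, satisfying Stability: whenever $X\mapsto e$, any two distinct $e_1,e_2\in X$ satisfy $e_1\leadsto e_2$. For a finite sequence $\sigma=e_1\cdots e_n$ write $\bar\sigma=\{e_1,\dots,e_n\}$, $\sigma_i=e_1\cdots e_i$ ($\sigma_0$ empty), and $\mathrm{en}_\varepsilon(\sigma)=\{e\in E\setminus\bar\sigma\mid(\forall X\subseteq E.\ X\mapsto e\Rightarrow X\cap\bar\sigma\neq\emptyset)\wedge\neg\exists e'\in\bar\sigma.\ e\leadsto e'\}$. $\sigma$ is a trace of $\varepsilon$ iff $e_i\in\mathrm{en}_\varepsilon(\sigma_{i-1})$ for all $1\le i\le n$. A prioritized EBES (PEBES) is a pair $(\varepsilon,\lessdot)$ with $\lessdot\subseteq E\times E$ acyclic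 ($e\lessdot e'$: $e'$ has higher priority). $\sigma=e_1\cdots e_n$ is a trace of $(\varepsilon,\lessdot)$ iff $\sigma$ is a trace of $\varepsilon$ and for all $0\le i<n$ and all $e_j,e_h\in\bar\sigma$ with $e_j\neq e_h$, $e_j,e_h\in\mathrm{en}_\varepsilon(\sigma_i)$ and $e_h\lessdot e_j$, we have $j<h$; $\mathrm{Traces}(\varepsilon,\lessdot)$ is the set of these traces. -}

module Defs where

open import Level using (Level; _⊔_; suc)
open import Data.Nat using (ℕ; _<_)
open import Data.Fin using (Fin; toℕ)
open import Data.List using (List; length; take; lookup)
open import Data.List.Membership.Propositional using (_∈_)
open import Data.Product using (_×_; ∃-syntax)
open import Relation.Nullary using (¬_)
open import Relation.Binary.PropositionalEquality using (_≡_)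
open import Relation.Binary.Construct.Closure.Transitive using (TransClosure)

Subset : Set → Set₁
Subset E = E → Set

record EBES (E : Set) (Act : Set) : Set₁ where
  field
    _⇝_      : E → E → Set
    _↦_      : Subset E → E → Set
    l        : E → Act
    irrefl   : ∀ e → ¬ (e ⇝ e)
    stability : ∀ (X : Subset E) e → X ↦ e →
                ∀ e₁ e₂ → X e₁ → X e₂ → ¬ (e₁ ≡ e₂) → e₁ ⇝ e₂

Acyclic : {E : Set} → (E → E → Set) → Set
Acyclic {E} R = ∀ (e : E) → ¬ TransClosure R e e

module _ {E Act : Set} (ε : EBES E Act) where
  open EBES ε

  -- en_ε(σ), as a predicate on events (σ̄ is list membership)
  en : List E → E → Set₁
  en σ e = ¬ (e ∈ σ)
         × (∀ (X : Subset E) → X ↦ e → ∃[ x ] (X x × x ∈ σ))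
         × ¬ (∃[ e' ] (e' ∈ σ × e ⇝ e'))

  -- σ is a trace of ε  (e_{i+1} ∈ en(σ_i), 0-based indexing)
  IsTrace : List E → Set₁
  IsTrace σ = ∀ (i : Fin (length σ)) → en (take (toℕ i) σ) (lookup σ i)

  -- σ is a trace of the PEBES (ε, ⋖); ⋖ is assumed acyclic separately.
  IsPTrace : (E → E → Set) → List E → Set₁
  IsPTrace _⋖_ σ =
    IsTrace σ ×
    (∀ (i : ℕ) → i < length σ → ∀ (j h : Fin (length σ)) →
       ¬ (lookup σ j ≡ lookup σ h) →
       en (take i σ) (lookup σ j) → en (take i σ) (lookup σ h) →
       lookup σ h ⋖ lookup σ j → toℕ j < toℕ h)

module Submission where

open import Defs
open import Data.List using (List)
open import Data.Product using (_,_)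

IsPTrace-mono : {E Act : Set} (ε : EBES E Act) {_⋖_ _⋖'_ : E → E → Set} →
  (∀ e e' → e ⋖' e' → e ⋖ e') →
  ∀ (σ : List E) → IsPTrace ε _⋖_ σ → IsPTrace ε _⋖'_ σ
IsPTrace-mono ε ⋖'⊆⋖ σ (trace , respects⋖) =
  trace , λ i i<∣σ∣ j h j≢h en-j en-h h⋖'j →
    respects⋖ i i<∣σ∣ j h j≢h en-j en-h (⋖'⊆⋖ _ _ h⋖'j)

-- Acyclicity is only needed for (ε, ⋖) to be a PEBES; the inclusion holds for arbitrary relations.
lemma3 : {E Act : Set} (ε : EBES E Act) (_⋖_ _⋖'_ : E → E → Set) →
    Acyclic _⋖_ → Acyclic _⋖'_ →
    (∀ e e' → e ⋖' e' → e ⋖ e') →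
    ∀ (σ : List E) → IsPTrace ε _⋖_ σ → IsPTrace ε _⋖'_ σ
lemma3 ε _⋖_ _⋖'_ _ _ = IsPTrace-mono ε
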